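{- Let $\pi$ be a permutation of length at least $2$ and $d$ an integer. If $w(\pi)\le d$, then $\pi$ has a $d$-close pair.
   Context: A permutation is a pair $\pi=(S,P)$, $S$ a finite set of positive integers, $P:S\to\mathbb{N}^2$ injective with $P(S)$ in general position. For $\alpha\in\{1,2\}$, $p<^{\pi}_{\alpha}p'$ means the $\alpha$-th coordinate of $P(p)$ is smaller than that of $P(p')$. For $p,p'\in S$, $\mathrm{Int}_\alpha(\pi,p,p')$ is the set of $p''\in S$ lying strictly between $p$ and $p'$ in the order $<^\pi_\alpha$. A pair $\{p,p'\}\subseteq S$ is a $d$-close pair of $\pi$ if $|\mathrm{Int}_\alpha(\pi,p,p')|<d$ for each $\alpha\in\{1,2\}$. Intervals are discrete; a rectangle is $R=I_1(R)\times I_2(R)$ with $I_1(R),I_2(R)$ intervals. A rectangle family is $\mathcal{R}=(S,R)$ assigning a rectangle $R(i)$ to each $i$ in a finite $S\subseteq\mathbb{N}$; $\pi$ is the family $R(i)=\{P(i)\}$. $\mathcal{R}[i,j\to k]$ ($k\notin S$) replaces $R(i),R(j)$ by their bounding box indexed $k$. A decomposition of $\pi$ is $(\mathcal{R}_0,\dots,\mathcal{R}_s)$, $\mathcal{R}_0=\pi$, with $\max S<k_1<\dots<k_s$, $\mathcal{R}_p=\mathcal{R}_{p-1}[i,j\to k_p]$ for some $i,j$, and $|\mathcal{R}_s|=1$. $R,R'$ $\alpha$-view each other if $I_\alpha(R)\cap I_\alpha(R')\ne\emptyset$; $\mathrm{view}(\mathcal{R},i)=\max_\alpha|\{j\in S\setminus\{i\}:R(i),R(j)\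 \alpha\text{ -view each other}\}|$; $\mathcal{R}$ is $d$-wide if $\mathrm{view}(\mathcal{R},i)<d$ for all $i$; a decomposition is $d$-wide if all its families are; $w(\pi)$ is the minimum $d$ such that $\pi$ has a $d$-wide decomposition. -}

module Defs where

open import Data.Nat using (ℕ; zero; suc; _<_; _≤_; _⊔_; _⊓_; _<ᵇ_; _≤ᵇ_; _≡ᵇ_)
open import Data.Integer as ℤ using (ℤ; +_)
open import Data.Bool using (Bool; true; false; _∧_; _∨_; not)
open import Data.Product using (_×_; _,_; proj₁; proj₂; Σ; ∃; ∃-syntax)
open import Data.List using (List; []; _∷_; map; length; filterᵇ; foldr)
open import Data.List.Membership.Propositional using (_∈_; _∉_)
open import Data.List.Relation.Unary.All using (All)
open import Data.List.Relation.Unary.AllPairs using (AllPairs)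
open import Relation.Binary.PropositionalEquality using (_≡_; _≢_)

Point : Set
Point = ℕ × ℕ

Entry : Set
Entry = ℕ × Point

label : Entry → ℕ
label = proj₁

coord₁ coord₂ : Entry → ℕ
coord₁ e = proj₁ (proj₂ e)
coord₂ e = proj₂ (proj₂ e)

-- π = (S , P) is given by the list of its entries (the graph of P).
-- Conditions: labels are positive integers; for any two distinct
-- entries the labels differ (so S is a set and P a function) and the
-- points are in general position (distinct first coordinates and
-- distinct second coordinates; in particular P is injective).
record Permutation : Set where
  field
    entries  : List Entry
    positive : All (λ e → 0 < label e) entries
    distinct : AllPairs (λ e e' → label e ≢ label e'
                                 × coord₁ e ≢ coord₁ e'
                                 × coord₂ e ≢ coord₂ e') entries
open Permutation public

size : Permutation → ℕ
size π = length (entries π)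

betweenᵇ : ℕ → ℕ → ℕ → Bool
betweenᵇ a c b = ((a <ᵇ c) ∧ (c <ᵇ b)) ∨ ((b <ᵇ c) ∧ (c <ᵇ a))

|Int₁| |Int₂| : Permutation → Entry → Entry → ℕ
|Int₁| π e e' = length (filterᵇ (λ q → betweenᵇ (coord₁ e) (coord₁ q) (coord₁ e')) (entries π))
|Int₂| π e e' = length (filterᵇ (λ q → betweenᵇ (coord₂ e) (coord₂ q) (coord₂ e')) (entries π))

HasClosePair : ℤ → Permutation → Set
HasClosePair d π =
  ∃[ e ] ∃[ e' ] (e ∈ entries π × e' ∈ entries π × label e ≢ label e'
                  × (+ |Int₁| π e e') ℤ.< d × (+ |Int₂| π e e') ℤ.< d)

-- A discrete interval [lo , hi] = {lo, …, hi} (all intervals that occur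
-- are built from points and bounding boxes, hence nonempty: lo ≤ hi).
Interval : Set
Interval = ℕ × ℕ

meetsᵇ : Interval → Interval → Bool
meetsᵇ (a , b) (c , d) = (a ≤ᵇ d) ∧ (c ≤ᵇ b)

hullI : Interval → Interval → Interval
hullI (a , b) (c , d) = (a ⊓ c , b ⊔ d)

Rect : Set
Rect = Interval × Interval

I₁ I₂ : Rect → Interval
I₁ = proj₁
I₂ = proj₂

bbox : Rect → Rect → Rect
bbox r r' = (hullI (I₁ r) (I₁ r') , hullI (I₂ r) (I₂ r'))

-- A rectangle family (S , R) as the list of pairs (i , R(i)).
Family : Set
Family = List (ℕ × Rect)

dom : Family → List ℕ
dom = map proj₁

toFamily : Permutation → Family
toFamily π = map (λ e → label e , ((coord₁ e , coord₁ e) , (coord₂ e , coord₂ e))) (entries π)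

maxLabel : Permutation → ℕ
maxLabel π = foldr _⊔_ 0 (map label (entries π))

removeIdx : ℕ → Family → Family
removeIdx i = filterᵇ (λ e → not (proj₁ e ≡ᵇ i))

Merge : Family → ℕ → ℕ → ℕ → Family → Set
Merge F i j k F' =
  i ≢ j × k ∉ dom F ×
  ∃[ ri ] ∃[ rj ] ((i , ri) ∈ F × (j , rj) ∈ F ×
                   F' ≡ (k , bbox ri rj) ∷ removeIdx i (removeIdx j F))

viewCount₁ viewCount₂ : Family → ℕ × Rect → ℕ
viewCount₁ F (i , r) = length (filterᵇ (λ e → not (proj₁ e ≡ᵇ i) ∧ meetsᵇ (I₁ r) (I₁ (proj₂ e))) F)
viewCount₂ F (i , r) = length (filterᵇ (λ e → not (proj₁ e ≡ᵇ i) ∧ meetsᵇ (I₂ r) (I₂ (proj₂ e))) F)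

view : Family → ℕ × Rect → ℕ
view F e = viewCount₁ F e ⊔ viewCount₂ F e

Wide : ℤ → Family → Set
Wide d F = All (λ e → (+ view F e) ℤ.< d) F

-- d-wide decompositions (R_p, …, R_s) starting at family F, where all
-- further merge indices must exceed m (m = max S initially, then k_p).
data WideDecomp (d : ℤ) : ℕ → Family → Set where
  done : ∀ {m F} → Wide d F → length F ≡ 1 → WideDecomp d m F
  step : ∀ {m F F'} (i j k : ℕ) → Wide d F → m < k → Merge F i j k F' →
         WideDecomp d k F' → WideDecomp d m F

HasWideDecomp : ℤ → Permutation → Set
HasWideDecomp d π = WideDecomp d (maxLabel π) (toFamily π)

-- w(π) ≤ d : the minimum d' with a d'-wide decomposition is ≤ d,
-- i.e. some d' ≤ d admits a d'-wide decomposition.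
w≤ : Permutation → ℤ → Set
w≤ π d = ∃[ d' ] (d' ℤ.≤ d × HasWideDecomp d' π)

-- The first step of a decomposition of π merges two points P(p), P(p') into their bounding
-- box B.  Every point strictly between them in the α-th order has its α-coordinate inside
-- I_α(B), so it α-views B in the next family; since that family is d'-wide, fewer than
-- d' ≤ d such points exist for each α, and {p, p'} is a d-close pair.
module Submission where

open import Defs
open import Data.Nat using (_≤_)
open import Data.Integer using (ℤ)

open import Data.Bool using (Bool; true; false; _∧_; not; T)
open import Data.Bool.Properties using (T-∧; T-∨; T-≡)
open import Data.Empty using (⊥; ⊥-elim)
open import Data.Integer as ℤ using (+_; +≤+)
import Data.Integer.Properties as ℤₚ
open import Data.List using (List; []; _∷_; map; length; filterᵇ)
open import Data.List.Membership.Propositional using (_∈_; _∉_)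
open import Data.List.Membership.Propositional.Properties using (∈-map⁺; ∈-map⁻)
open import Data.List.Properties using (length-map)
import Data.List.Relation.Unary.All as All
open import Data.List.Relation.Unary.AllPairs using (AllPairs; _∷_)
open import Data.List.Relation.Unary.Any using (here; there)
open import Data.Nat using (ℕ; _<_; _⊓_; _⊔_; _≡ᵇ_; z≤n; s≤s)
open import Data.Nat.Properties
  using (<ᵇ⇒<; ≤⇒≤ᵇ; ≡ᵇ⇒≡; ≡⇒≡ᵇ; <⇒≤; <-irrefl; ≤-reflexive; ≤-trans; m≤n⇒m≤1+n; m⊓n≤m; m⊓n≤n; m≤m⊔n; m≤n⊔m; module ≤-Reasoning)
open import Data.Product using (_×_; _,_; proj₁; proj₂)
open import Data.Sum using (_⊎_; inj₁; inj₂)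
open import Function.Bundles using (Equivalence)
open import Relation.Binary.PropositionalEquality using (_≡_; _≢_; refl; sym; trans; cong)

private
  variable
    A B : Set

length-filterᵇ-map-mono : (g : A → B) {p : A → Bool} {q : B → Bool} (xs : List A) →
  (∀ {x} → x ∈ xs → T (p x) → T (q (g x))) →
  length (filterᵇ p xs) ≤ length (filterᵇ q (map g xs))
length-filterᵇ-map-mono g [] p⇒q = z≤n
length-filterᵇ-map-mono g {p} {q} (x ∷ xs) p⇒q
  with ih ← length-filterᵇ-map-mono g xs (λ x∈ → p⇒q (there x∈))
     | p x | q (g x) | p⇒q {x} (here refl)
... | false | false | _   = ih
... | false | true  | _   = m≤n⇒m≤1+n ih
... | true  | true  | _   = s≤s ih
... | true  | false | p⇒⊥ = ⊥-elim (p⇒⊥ _)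

filterᵇ-filterᵇ : (p q : A → Bool) (xs : List A) →
  filterᵇ q (filterᵇ p xs) ≡ filterᵇ (λ x → p x ∧ q x) xs
filterᵇ-filterᵇ p q [] = refl
filterᵇ-filterᵇ p q (x ∷ xs) with ih ← filterᵇ-filterᵇ p q xs | p x
... | false = ih
... | true with q x
...   | false = ih
...   | true  = cong (x ∷_) ih

T-not-≡ᵇ : ∀ {m n} → m ≢ n → T (not (m ≡ᵇ n))
T-not-≡ᵇ {m} {n} m≢n with m ≡ᵇ n in eq
... | false = _
... | true  = m≢n (≡ᵇ⇒≡ m n (Equivalence.from T-≡ eq))

T-betweenᵇ⇒ : ∀ a c b → T (betweenᵇ a c b) → (a < c × c < b) ⊎ (b < c × c < a)
T-betweenᵇ⇒ a c b h with Equivalence.to T-∨ h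
... | inj₁ h₁ = let (a<c , c<b) = Equivalence.to T-∧ h₁ in inj₁ (<ᵇ⇒< a c a<c , <ᵇ⇒< c b c<b)
... | inj₂ h₂ = let (b<c , c<a) = Equivalence.to T-∧ h₂ in inj₂ (<ᵇ⇒< b c b<c , <ᵇ⇒< c a c<a)

betweenᵇ-irreflˡ : ∀ a b → T (betweenᵇ a a b) → ⊥
betweenᵇ-irreflˡ a b h with T-betweenᵇ⇒ a a b h
... | inj₁ (a<a , _) = <-irrefl refl a<a
... | inj₂ (_ , a<a) = <-irrefl refl a<a

betweenᵇ-irreflʳ : ∀ a b → T (betweenᵇ a b b) → ⊥
betweenᵇ-irreflʳ a b h with T-betweenᵇ⇒ a b b h
... | inj₁ (_ , b<b) = <-irrefl refl b<b
... | inj₂ (b<b , _) = <-irrefl refl b<b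

betweenᵇ⇒meetsᵇ-hull : ∀ a c b → T (betweenᵇ a c b) → T (meetsᵇ (hullI (a , a) (b , b)) (c , c))
betweenᵇ⇒meetsᵇ-hull a c b h = Equivalence.from T-∧ (≤⇒≤ᵇ lower , ≤⇒≤ᵇ upper)
  where
  lower : a ⊓ b ≤ c
  lower with T-betweenᵇ⇒ a c b h
  ... | inj₁ (a<c , _) = ≤-trans (m⊓n≤m a b) (<⇒≤ a<c)
  ... | inj₂ (b<c , _) = ≤-trans (m⊓n≤n a b) (<⇒≤ b<c)
  upper : c ≤ a ⊔ b
  upper with T-betweenᵇ⇒ a c b h
  ... | inj₁ (_ , c<b) = ≤-trans (<⇒≤ c<b) (m≤n⊔m a b)
  ... | inj₂ (_ , c<a) = ≤-trans (<⇒≤ c<a) (m≤m⊔n a b)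

-- toFamily π is definitionally map pointRect (entries π).
pointRect : Entry → ℕ × Rect
pointRect e = label e , ((coord₁ e , coord₁ e) , (coord₂ e , coord₂ e))

mergeAt : ℕ → ℕ × Rect → ℕ × Rect → Family → Family
mergeAt k (i , r) (j , r') F = (k , bbox r r') ∷ removeIdx i (removeIdx j F)

Separated : Entry → Entry → Set
Separated e e' = label e ≢ label e' × coord₁ e ≢ coord₁ e' × coord₂ e ≢ coord₂ e'

label-injective : ∀ π {e e'} → e ∈ entries π → e' ∈ entries π → label e ≡ label e' → e ≡ e'
label-injective π = go (distinct π)
  where
  go : ∀ {xs e e'} → AllPairs Separated xs → e ∈ xs → e' ∈ xs → label e ≡ label e' → e ≡ e'
  go (_ ∷ _)     (here refl) (here refl) _  = refl
  go (e≠ ∷ _)    (here refl) (there e'∈) eq = ⊥-elim (proj₁ (All.lookup e≠ e'∈) eq)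
  go (e'≠ ∷ _)   (there e∈)  (here refl) eq = ⊥-elim (proj₁ (All.lookup e'≠ e∈) (sym eq))
  go (_ ∷ rest)  (there e∈)  (there e'∈) eq = go rest e∈ e'∈ eq

|Int|[_] : (Entry → ℕ) → Permutation → Entry → Entry → ℕ
|Int|[ c ] π e e' = length (filterᵇ (λ q → betweenᵇ (c e) (c q) (c e')) (entries π))

viewCount[_] : (Rect → Interval) → Family → ℕ × Rect → ℕ
viewCount[ I ] F (i , r) = length (filterᵇ (λ x → not (proj₁ x ≡ᵇ i) ∧ meetsᵇ (I r) (I (proj₂ x))) F)

viewCount-cons-self : ∀ I G k r → viewCount[ I ] ((k , r) ∷ G) (k , r) ≡ viewCount[ I ] G (k , r)
viewCount-cons-self I G k r rewrite Equivalence.to T-≡ (≡⇒≡ᵇ k k refl) = refl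

-- Stated for an arbitrary axis (c, I) so that both coordinates are handled at once; the two
-- hypotheses hold by refl for (coord₁, I₁) and (coord₂, I₂).
|Int|≤viewCount-mergeAt : (c : Entry → ℕ) (I : Rect → Interval) →
  (∀ e → I (proj₂ (pointRect e)) ≡ (c e , c e)) →
  (∀ r r' → I (bbox r r') ≡ hullI (I r) (I r')) →
  ∀ π {e e' k} → e ∈ entries π → e' ∈ entries π → k ∉ dom (toFamily π) →
  |Int|[ c ] π e e' ≤ viewCount[ I ] (mergeAt k (pointRect e) (pointRect e') (toFamily π))
                                      (k , bbox (proj₂ (pointRect e)) (proj₂ (pointRect e')))
|Int|≤viewCount-mergeAt c I I-point I-bbox π {e} {e'} {k} e∈ e'∈ k∉ = begin
  |Int|[ c ] π e e'
    ≤⟨ length-filterᵇ-map-mono pointRect (entries π) counted ⟩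
  length (filterᵇ (λ x → notAt j x ∧ (notAt i x ∧ views x)) F)
    ≡⟨ cong length (sym (trans (filterᵇ-filterᵇ (notAt i) views (removeIdx j F))
                              (filterᵇ-filterᵇ (notAt j) _ F))) ⟩
  viewCount[ I ] (removeIdx i (removeIdx j F)) (k , box)
    ≡⟨ sym (viewCount-cons-self I _ k box) ⟩
  viewCount[ I ] (mergeAt k (pointRect e) (pointRect e') F) (k , box) ∎
  where
  open ≤-Reasoning
  F : Family
  F = toFamily π
  i j : ℕ
  i = label e
  j = label e'
  box : Rect
  box = bbox (proj₂ (pointRect e)) (proj₂ (pointRect e'))
  notAt : ℕ → ℕ × Rect → Bool
  notAt l x = not (proj₁ x ≡ᵇ l)
  views : ℕ × Rect → Bool
  views x = notAt k x ∧ meetsᵇ (I box) (I (proj₂ x))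

  counted : ∀ {q} → q ∈ entries π → T (betweenᵇ (c e) (c q) (c e')) →
            T (notAt j (pointRect q) ∧ (notAt i (pointRect q) ∧ views (pointRect q)))
  counted {q} q∈ between = pair (T-not-≡ᵇ q≢e') (pair (T-not-≡ᵇ q≢e) (pair (T-not-≡ᵇ q≢k) meets))
    where
    pair : ∀ {a b} → T a → T b → T (a ∧ b)
    pair Ta Tb = Equivalence.from T-∧ (Ta , Tb)
    q≢e' : label q ≢ j
    q≢e' eq with refl ← label-injective π q∈ e'∈ eq = betweenᵇ-irreflʳ (c e) (c q) between
    q≢e : label q ≢ i
    q≢e eq with refl ← label-injective π q∈ e∈ eq = betweenᵇ-irreflˡ (c q) (c e') between
    q≢k : label q ≢ k
    q≢k refl = k∉ (∈-map⁺ proj₁ (∈-map⁺ pointRect q∈))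
    meets : T (meetsᵇ (I box) (I (proj₂ (pointRect q))))
    meets rewrite I-bbox (proj₂ (pointRect e)) (proj₂ (pointRect e'))
                | I-point e | I-point e' | I-point q = betweenᵇ⇒meetsᵇ-hull (c e) (c q) (c e') between

record FirstMerge (d : ℤ) (π : Permutation) : Set where
  field
    p p' : Entry
    k    : ℕ
    p∈   : p ∈ entries π
    p'∈  : p' ∈ entries π
    p≢p' : label p ≢ label p'
    k∉   : k ∉ dom (toFamily π)
    wide : Wide d (mergeAt k (pointRect p) (pointRect p') (toFamily π))

firstMerge : ∀ {d} π → 2 ≤ size π → HasWideDecomp d π → FirstMerge d π
firstMerge π 2≤|π| (done _ |π|≡1) =
  ⊥-elim (<-irrefl refl (≤-trans 2≤|π| (≤-reflexive (trans (sym (length-map pointRect (entries π))) |π|≡1))))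
firstMerge π _ (step _ _ k _ _ (i≢j , k∉ , _ , _ , i∈ , j∈ , refl) rest)
  with ∈-map⁻ pointRect i∈ | ∈-map⁻ pointRect j∈
... | p , p∈ , refl | p' , p'∈ , refl = record
  { p∈ = p∈ ; p'∈ = p'∈ ; p≢p' = i≢j ; k∉ = k∉ ; wide = wideHead rest }
  where
  wideHead : ∀ {d m F} → WideDecomp d m F → Wide d F
  wideHead (done w _)           = w
  wideHead (step _ _ _ w _ _ _) = w

proposition1 : (π : Permutation) (d : ℤ) → 2 ≤ size π → w≤ π d → HasClosePair d π
proposition1 π d 2≤|π| (d' , d'≤d , decomp) =
  p , p' , p∈ , p'∈ , p≢p' ,
  below-d (≤-trans (|Int|≤viewCount-mergeAt coord₁ I₁ (λ _ → refl) (λ _ _ → refl) π p∈ p'∈ k∉)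
                   (m≤m⊔n _ _)) ,
  below-d (≤-trans (|Int|≤viewCount-mergeAt coord₂ I₂ (λ _ → refl) (λ _ _ → refl) π p∈ p'∈ k∉)
                   (m≤n⊔m _ _))
  where
  open FirstMerge (firstMerge π 2≤|π| decomp)
  merged : Family
  merged = mergeAt k (pointRect p) (pointRect p') (toFamily π)
  box : Rect
  box = bbox (proj₂ (pointRect p)) (proj₂ (pointRect p'))
  below-d : ∀ {n} → n ≤ view merged (k , box) → + n ℤ.< d
  below-d n≤view = ℤₚ.<-≤-trans (ℤₚ.≤-<-trans (+≤+ n≤view) (All.head wide)) d'≤d
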